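{- Let $R$ be a transit function on a non-empty finite set $V$ satisfying Axioms (b1'), (J2), (J4), (J4') and (TW1'). Then the underlying graph $G_R$ is AT-free.
   Context: A transit function on a set $V$ is a map $R:V\times V\to 2^V$ such that for all $u,v\in V$: $u\in R(u,v)$, $R(u,v)=R(v,u)$ and $R(u,u)=\{u\}$. The underlying graph $G_R$ has vertex set $V$, and distinct $u,v$ are adjacent iff $R(u,v)=\{u,v\}$. Three vertices form an asteroidal triple if each two of them are joined by a path containing no neighbor of the third; a graph is AT-free if it has no asteroidal triple. The axioms (all quantified over elements of $V$): (b1') If $x\in R(u,v)$, $v\neq x$ and $R(v,x)\neq\{v,x\}$, then $v\notin R(u,x)$. (J2) If $R(u,x)=\{u,x\}$, $R(x,v)=\{x,v\}$, $u\neq v$ and $R(u,v)\neq\{u,v\}$, then $x\in R(u,v)$. (J4) If $x\in R(u,y)$, $y\in R(x,v)$, $x\neq y$, $R(u,x)=\{u,x\}$, $R(y,v)=\{y,v\}$ and $R(u,v)\neq\{u,v\}$, then $x\in R(u,v)$. (J4') If $x\in R(u,y)$, $y\in R(x,v)$, $R(u,x)\neq\{u,x\}$, $R(y,v)\neq\{y,v\}$, $R(x,y)\neq\{x,y\}$ and $R(u,v)\neq\{u,v\}$, then $x\in R(u,v)$. (TW1') If $x,y\in R(u,v)$, $x\neq u$, $y\neq v$, $R(x,v)\neq\{x,v\}$, $R(u,y)\neq\{u,y\}$, $R(x,z)=\{x,z\}$, $R(z,w)=\{z,w\}$, $R(w,y)=\{w,y\}$ and $R(u,w)\neq\{u,w\}$,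 then $z\in R(u,v)$. -}

module Defs where

open import Data.Nat using (ℕ)
open import Data.Fin using (Fin)
open import Data.Fin.Subset using (Subset; _∈_; _∉_)
open import Data.List using (List; []; _∷_)
open import Data.List.Relation.Unary.All using (All)
open import Data.Product using (_×_; Σ; ∃; ∃-syntax; _,_)
open import Data.Sum using (_⊎_)
open import Relation.Binary.PropositionalEquality using (_≡_)
open import Relation.Nullary using (¬_)
open import Level using (0ℓ)

RMap : ℕ → Set
RMap n = Fin n → Fin n → Subset n

IsPair : ∀ {n} → Subset n → Fin n → Fin n → Set
IsPair S u v = ∀ z → (z ∈ S → (z ≡ u ⊎ z ≡ v)) × ((z ≡ u ⊎ z ≡ v) → z ∈ S)

IsSingleton : ∀ {n} → Subset n → Fin n → Set
IsSingleton S u = ∀ z → (z ∈ S → z ≡ u) × (z ≡ u → z ∈ S)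

record IsTransit {n} (R : RMap n) : Set where
  field
    t1 : ∀ u v → u ∈ R u v
    t2 : ∀ u v → R u v ≡ R v u
    t3 : ∀ u → IsSingleton (R u u) u

Adj : ∀ {n} → RMap n → Fin n → Fin n → Set
Adj R u v = ¬ (u ≡ v) × IsPair (R u v) u v

B1' : ∀ {n} → RMap n → Set
B1' R = ∀ u v x → x ∈ R u v → ¬ (v ≡ x) → ¬ IsPair (R v x) v x → v ∉ R u x

J2 : ∀ {n} → RMap n → Set
J2 R = ∀ u v x → IsPair (R u x) u x → IsPair (R x v) x v → ¬ (u ≡ v)
       → ¬ IsPair (R u v) u v → x ∈ R u v

J4 : ∀ {n} → RMap n → Set
J4 R = ∀ u v x y → x ∈ R u y → y ∈ R x v → ¬ (x ≡ y)
       → IsPair (R u x) u x → IsPair (R y v) y v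
       → ¬ IsPair (R u v) u v → x ∈ R u v

J4' : ∀ {n} → RMap n → Set
J4' R = ∀ u v x y → x ∈ R u y → y ∈ R x v
        → ¬ IsPair (R u x) u x → ¬ IsPair (R y v) y v → ¬ IsPair (R x y) x y
        → ¬ IsPair (R u v) u v → x ∈ R u v

TW1' : ∀ {n} → RMap n → Set
TW1' R = ∀ u v x y z w → x ∈ R u v → y ∈ R u v → ¬ (x ≡ u) → ¬ (y ≡ v)
         → ¬ IsPair (R x v) x v → ¬ IsPair (R u y) u y
         → IsPair (R x z) x z → IsPair (R z w) z w → IsPair (R w y) w y
         → ¬ IsPair (R u w) u w → z ∈ R u v

data Walk {n} (E : Fin n → Fin n → Set) : Fin n → Fin n → List (Fin n) → Set where
  here : ∀ a → Walk E a a (a ∷ [])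
  step : ∀ {a b c vs} → E a b → Walk E b c vs → Walk E a c (a ∷ vs)

Avoids : ∀ {n} → (Fin n → Fin n → Set) → Fin n → Fin n → Set
Avoids E w c = ¬ (c ≡ w) × ¬ E w c

JoinedAvoiding : ∀ {n} → (Fin n → Fin n → Set) → Fin n → Fin n → Fin n → Set
JoinedAvoiding E a b w = ∃[ vs ] (Walk E a b vs × All (Avoids E w) vs)

AsteroidalTriple : ∀ {n} → (Fin n → Fin n → Set) → Fin n → Fin n → Fin n → Set
AsteroidalTriple E a b c =
  ¬ (a ≡ b) × ¬ (b ≡ c) × ¬ (a ≡ c) ×
  JoinedAvoiding E a b c × JoinedAvoiding E b c a × JoinedAvoiding E a c b

ATFree : ∀ {n} → (Fin n → Fin n → Set) → Set
ATFree E = ∀ a b c → ¬ AsteroidalTriple E a b c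

-- Write u ~ v for R(u,v) = {u,v} (so ~ is reflexive) and N[u] for the
-- closed neighbourhood of u. The heart of the argument is that, for u ≁ v, every
-- vertex z that reaches u outside N[v] and reaches v outside N[u] lies in R(u,v).
-- Along such walks one finds a walk u ~ x ~ a ⋯ c ~ y ~ v whose inner part a ⋯ c
-- avoids N[u] ∪ N[v]; (J2) and (J4) put x and y into R(u,v), (TW1') then puts a
-- there, an induction on shortcuts using (J4') handles long inner parts, and (TW1')
-- again spreads membership along the inner part back to z. For an asteroidal triple
-- a, b, c this gives c ∈ R(a,b) and b ∈ R(a,c) although b ≁ c, contradicting (b1').
module Submission where

open import Data.Nat using (ℕ; suc; _+_; _<_; z<s; s<s)
open import Data.Nat.Induction using (<-wellFounded)
open import Data.Nat.Properties using (n<1+n; m<n⇒m<1+n; m<m+n; m≤n+m)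
open import Data.Fin using (Fin; _≟_)
open import Data.Fin.Subset using (_∈_)
open import Data.Fin.Subset.Properties using (_∈?_)
open import Data.Fin.Properties using (all?)
open import Data.List.Relation.Unary.All using ([]; _∷_)
open import Data.Product using (_,_; proj₁; proj₂; ∃) renaming (swap to ×-swap)
open import Data.Sum using (inj₁; inj₂) renaming (swap to ⊎-swap)
open import Data.Empty using (⊥-elim)
open import Function using (_∘_)
open import Induction.WellFounded using (Acc; acc)
open import Level using (0ℓ)
open import Relation.Binary.PropositionalEquality using (_≢_; refl; sym; subst)
open import Relation.Nullary using (¬_; Dec; yes; no)
open import Relation.Nullary.Decidable using (_×-dec_; _⊎-dec_; _→-dec_)
open import Relation.Unary using (Pred; _∩_; ∁)

open import Defs

module _ {n} {R : RMap n} (transit : IsTransit R) where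
  open IsTransit transit

  infix 4 _~_ _≁_ _~?_

  _~_ _≁_ : Fin n → Fin n → Set
  u ~ v = IsPair (R u v) u v
  u ≁ v = ¬ u ~ v

  ~-refl : ∀ u → u ~ u
  ~-refl u z = inj₁ ∘ proj₁ (t3 u z) , λ { (inj₁ e) → proj₂ (t3 u z) e ; (inj₂ e) → proj₂ (t3 u z) e }

  ~-sym : ∀ {u v} → u ~ v → v ~ u
  ~-sym {u} {v} u~v z rewrite t2 v u = ⊎-swap ∘ proj₁ (u~v z) , proj₂ (u~v z) ∘ ⊎-swap

  ≁-sym : ∀ {u v} → u ≁ v → v ≁ u
  ≁-sym u≁v = u≁v ∘ ~-sym

  ≁⇒≢ : ∀ {u v} → u ≁ v → u ≢ v
  ≁⇒≢ u≁v refl = u≁v (~-refl _)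

  _~?_ : ∀ u v → Dec (u ~ v)
  u ~? v = all? λ z → ((z ∈? R u v) →-dec ((z ≟ u) ⊎-dec (z ≟ v)))
                ×-dec (((z ≟ u) ⊎-dec (z ≟ v)) →-dec (z ∈? R u v))

  ∈R-sym : ∀ {z u v} → z ∈ R v u → z ∈ R u v
  ∈R-sym {z} {u} {v} = subst (z ∈_) (t2 v u)

  infixr 5 _∷⟨_⟩_

  data WalkIn (P : Pred (Fin n) 0ℓ) : ℕ → Fin n → Fin n → Set where
    [_]    : ∀ {a} → P a → WalkIn P 0 a a
    _∷⟨_⟩_ : ∀ {k a b c} → P a → a ~ b → WalkIn P k b c → WalkIn P (suc k) a c

  module _ {P : Pred (Fin n) 0ℓ} where
    infixl 5 _∷ʳ⟨_⟩_

    head : ∀ {k a c} → WalkIn P k a c → P a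
    head [ p ]        = p
    head (p ∷⟨ _ ⟩ _) = p

    last : ∀ {k a c} → WalkIn P k a c → P c
    last [ p ]        = p
    last (_ ∷⟨ _ ⟩ w) = last w

    map : ∀ {Q : Pred (Fin n) 0ℓ} {k a c} → (∀ {x} → P x → Q x) → WalkIn P k a c → WalkIn Q k a c
    map f [ p ]        = [ f p ]
    map f (p ∷⟨ e ⟩ w) = f p ∷⟨ e ⟩ map f w

    _∷ʳ⟨_⟩_ : ∀ {k a b c} → WalkIn P k a b → b ~ c → P c → WalkIn P (suc k) a c
    [ p ]        ∷ʳ⟨ e ⟩ q = p ∷⟨ e ⟩ [ q ]
    (p ∷⟨ e ⟩ w) ∷ʳ⟨ f ⟩ q = p ∷⟨ e ⟩ (w ∷ʳ⟨ f ⟩ q)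

    reverse : ∀ {k a c} → WalkIn P k a c → WalkIn P k c a
    reverse [ p ]        = [ p ]
    reverse (p ∷⟨ e ⟩ w) = reverse w ∷ʳ⟨ ~-sym e ⟩ p

    _++_ : ∀ {k l a b c} → WalkIn P k a b → WalkIn P l b c → WalkIn P (k + l) a c
    [ _ ]        ++ w' = w'
    (p ∷⟨ e ⟩ w) ++ w' = p ∷⟨ e ⟩ (w ++ w')

  data Split (P Q : Pred (Fin n) 0ℓ) : ℕ → Fin n → Fin n → Set where
    missed    : ∀ {k a c} → WalkIn (P ∩ ∁ Q) k a c → Split P Q k a c
    hitAtHead : ∀ {k a c} → Q a → WalkIn P k a c → Split P Q k a c
    hitAfter  : ∀ {i j a z y c} → WalkIn (P ∩ ∁ Q) i a z → z ~ y → Q y → WalkIn P j y c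
              → Split P Q (suc (i + j)) a c

  split-at-first : ∀ {P Q : Pred (Fin n) 0ℓ} → (∀ x → Dec (Q x)) → ∀ {k a c} → WalkIn P k a c → Split P Q k a c
  split-at-first Q? {a = a} [ p ] with Q? a
  ... | yes q = hitAtHead q [ p ]
  ... | no ¬q = missed [ p , ¬q ]
  split-at-first Q? {a = a} (p ∷⟨ e ⟩ w) with Q? a
  ... | yes q = hitAtHead q (p ∷⟨ e ⟩ w)
  ... | no ¬q with split-at-first Q? w
  ...   | missed w'            = missed ((p , ¬q) ∷⟨ e ⟩ w')
  ...   | hitAtHead q w'       = hitAfter [ p , ¬q ] e q w'
  ...   | hitAfter w' e' q w'' = hitAfter ((p , ¬q) ∷⟨ e ⟩ w') e' q w''

  first-step∈R : J2 R → J4 R → ∀ {k u v x q} → u ~ x → u ≁ v → x ~ q → WalkIn (u ≁_) k q v → x ∈ R u v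
  first-step∈R j2 j4 = go (<-wellFounded _)
    where
    go : ∀ {k u v x q} → Acc _<_ k → u ~ x → u ≁ v → x ~ q → WalkIn (u ≁_) k q v → x ∈ R u v
    go {u = u} {v} {x} {q} (acc rec) u~x u≁v x~q W with x ~? v
    ... | yes x~v = j2 u v x u~x x~v (≁⇒≢ u≁v) u≁v
    ... | no x≁v with split-at-first (_~? v) W
    ...   | missed W' = ⊥-elim (proj₂ (last W') (~-refl v))
    ...   | hitAtHead q~v _ =
            j4 u v x q x∈Ruq q∈Rxv (λ { refl → u≁q u~x }) u~x q~v u≁v
      where
      u≁q : u ≁ q
      u≁q = head W
      x∈Ruq : x ∈ R u q
      x∈Ruq = j2 u q x u~x x~q (≁⇒≢ u≁q) u≁q
      q∈Rxv : q ∈ R x v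
      q∈Rxv = j2 x v q x~q q~v (≁⇒≢ x≁v) x≁v
    ...   | hitAfter pre z~v _ [ _ ] = ⊥-elim (proj₂ (last pre) z~v)
    ...   | hitAfter {i} {suc j} {y = y} pre z~y y~v (u≁y ∷⟨ _ ⟩ _) =
            j4 u v x y x∈Ruy y∈Rxv (λ { refl → u≁y u~x }) u~x y~v u≁v
      where
      shorter : suc i < suc (i + suc j)
      shorter = s<s (m<m+n i z<s)
      x∈Ruy : x ∈ R u y
      x∈Ruy = go (rec shorter) u~x u≁y x~q (map proj₁ pre ∷ʳ⟨ z~y ⟩ u≁y)
      y∈Rxv : y ∈ R x v
      y∈Rxv = ∈R-sym (go (rec shorter) (~-sym y~v) (≁-sym x≁v) (~-sym z~y)
                        (reverse (map (≁-sym ∘ proj₂) pre) ∷ʳ⟨ ~-sym x~q ⟩ ≁-sym x≁v))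

  Far : Fin n → Fin n → Pred (Fin n) 0ℓ
  Far u v = (u ≁_) ∩ (_≁ v)

  ∈R-spreads-from-far : TW1' R → ∀ {u v b a} → Far u v b → b ∈ R u v → b ~ a → a ∈ R u v
  ∈R-spreads-from-far tw1' {u} {v} {b} {a} (u≁b , b≁v) b∈R b~a =
    tw1' u v b b a b b∈R b∈R (≁⇒≢ u≁b ∘ sym) (≁⇒≢ b≁v) b≁v u≁b b~a (~-sym b~a) (~-refl b) u≁b

  ∈R-along-far-walk : TW1' R → ∀ {k u v a c} → WalkIn (Far u v) k a c → c ∈ R u v → a ∈ R u v
  ∈R-along-far-walk tw1' [ _ ]          c∈R = c∈R
  ∈R-along-far-walk tw1' (_ ∷⟨ e ⟩ w) c∈R =
    ∈R-spreads-from-far tw1' (head w) (∈R-along-far-walk tw1' w c∈R) (~-sym e)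

  record Ends (u x y v : Fin n) : Set where
    constructor ends
    field
      u≁v : u ≁ v
      u~x : u ~ x
      x≁v : x ≁ v
      y~v : y ~ v
      u≁y : u ≁ y

  short-bridge∈R : J2 R → J4 R → TW1' R → ∀ {u x y v a w} → Ends u x y v
                 → x ~ a → a ~ w → w ~ y → Far u v a → Far u v w → a ∈ R u v
  short-bridge∈R j2 j4 tw1' {u} {x} {y} {v} {a} {w} (ends u≁v u~x x≁v y~v u≁y)
                 x~a a~w w~y (u≁a , a≁v) (u≁w , w≁v) =
    tw1' u v x y a w x∈R y∈R (λ { refl → u≁a x~a }) (λ { refl → w≁v w~y })
         x≁v u≁y x~a a~w w~y u≁w
    where
    x∈R : x ∈ R u v
    x∈R = first-step∈R j2 j4 u~x u≁v x~a (u≁a ∷⟨ a~w ⟩ u≁w ∷⟨ w~y ⟩ u≁y ∷⟨ y~v ⟩ [ u≁v ])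
    y∈R : y ∈ R u v
    y∈R = ∈R-sym (first-step∈R j2 j4 (~-sym y~v) (≁-sym u≁v) (~-sym w~y)
            (≁-sym w≁v ∷⟨ ~-sym a~w ⟩ ≁-sym a≁v ∷⟨ ~-sym x~a ⟩ ≁-sym x≁v ∷⟨ ~-sym u~x ⟩ [ ≁-sym u≁v ]))

  second-step∈R : J2 R → J4 R → J4' R → TW1' R → ∀ {k u x y v a c} → Ends u x y v
                → x ~ a → WalkIn (Far u v) k a c → c ~ y → a ∈ R u v
  second-step∈R j2 j4 j4' tw1' = go (<-wellFounded _)
    where
    go : ∀ {k u x y v a c} → Acc _<_ k → Ends u x y v
       → x ~ a → WalkIn (Far u v) k a c → c ~ y → a ∈ R u v
    go _ E x~a [ a-far ] a~y = short-bridge∈R j2 j4 tw1' E x~a (~-refl _) a~y a-far a-far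
    go _ E x~a (a-far ∷⟨ a~c ⟩ [ c-far ]) c~y = short-bridge∈R j2 j4 tw1' E x~a a~c c~y a-far c-far
    go {suc (suc l)} {u} {x} {y} {v} {a} (acc rec) E x~a
       (a-far ∷⟨ a~b ⟩ _∷⟨_⟩_ {b = h} b-far b~h rest) c~y with x ~? h
    -- Unless x or a has a neighbour further along, u ~ x ~ a ~ b ~ h is induced and (J4')
    -- splits the problem at a and h into two bridges with shorter inner parts.
    ... | yes x~h = ∈R-along-far-walk tw1' (a-far ∷⟨ a~b ⟩ b-far ∷⟨ b~h ⟩ [ head rest ])
                      (go (rec (m<n⇒m<1+n (n<1+n l))) E x~h rest c~y)
    ... | no x≁h with split-at-first (a ~?_) rest
    ...   | hitAtHead a~h _ = go (rec (n<1+n _)) E x~a (a-far ∷⟨ a~h ⟩ rest) c~y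
    ...   | hitAfter {i} {j} _ _ a~w suffix =
            go (rec (s<s (m<n⇒m<1+n (s<s (m≤n+m j i))))) E x~a (a-far ∷⟨ a~w ⟩ suffix) c~y
    ...   | missed rest' with a ~? y
    ...     | yes a~y = short-bridge∈R j2 j4 tw1' E x~a (~-refl a) a~y a-far a-far
    ...     | no a≁y = j4' u v a _ a∈Ruh h∈Rav u≁a (proj₂ (head rest)) (proj₂ (head rest')) u≁v
      where
      open Ends E
      u≁a : u ≁ a
      u≁a = proj₁ a-far
      a∈Ruh : a ∈ R u h
      a∈Ruh = go (rec z<s) (ends (proj₁ (head rest)) u~x x≁h b~h (proj₁ b-far))
                 x~a [ u≁a , proj₂ (head rest') ] a~b
      h∈Rav : h ∈ R a v
      h∈Rav = go (rec (m<n⇒m<1+n (n<1+n l))) (ends (proj₂ a-far) a~b (proj₂ b-far) y~v a≁y) b~h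
                 (map (λ { ((_ , w≁v) , a≁w) → a≁w , w≁v }) rest') c~y

  ∈R-of-avoiding-walks : J2 R → J4 R → J4' R → TW1' R → ∀ {k l u v z} → u ≁ v
                       → WalkIn (_≁ v) k z u → WalkIn (u ≁_) l z v → z ∈ R u v
  ∈R-of-avoiding-walks j2 j4 j4' tw1' {u = u} {v} u≁v A B with split-at-first (u ~?_) A
  ... | missed A'       = ⊥-elim (proj₂ (last A') (~-refl u))
  ... | hitAtHead u~z _ = ⊥-elim (head B u~z)
  ... | hitAfter preA p~x u~x sufA with split-at-first (_~? v) B
  ...   | missed B'       = ⊥-elim (proj₂ (last B') (~-refl v))
  ...   | hitAtHead z~v _ = ⊥-elim (head A z~v)
  ...   | hitAfter preB q~y y~v sufB =
          ∈R-along-far-walk tw1' (map ×-swap preA)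
            (second-step∈R j2 j4 j4' tw1' (ends u≁v u~x (head sufA) y~v (head sufB))
               (~-sym p~x) (reverse (map ×-swap preA) ++ preB) q~y)

  avoids⇒≁ : ∀ {w c} → Avoids (Adj R) w c → w ≁ c
  avoids⇒≁ {w} {c} (c≢w , ¬adj) w~c with w ≟ c
  ... | yes refl = c≢w refl
  ... | no w≢c   = ¬adj (w≢c , w~c)

  walk-avoiding : ∀ {a b w} → JoinedAvoiding (Adj R) a b w → ∃ λ k → WalkIn (w ≁_) k a b
  walk-avoiding (_ , here _ , avoids ∷ []) = _ , [ avoids⇒≁ avoids ]
  walk-avoiding (_ , step (_ , e) W , avoids ∷ all) =
    let k , W' = walk-avoiding (_ , W , all) in suc k , avoids⇒≁ avoids ∷⟨ e ⟩ W'

  at-free : B1' R → J2 R → J4 R → J4' R → TW1' R → ATFree (Adj R)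
  at-free b1' j2 j4 j4' tw1' a b c (_ , b≢c , _ , ab-avoiding-c , bc-avoiding-a , ac-avoiding-b) =
    b1' a b c c∈Rab b≢c (last ac) b∈Rac
    where
    ab : WalkIn (c ≁_) _ a b
    ab = proj₂ (walk-avoiding ab-avoiding-c)
    bc : WalkIn (a ≁_) _ b c
    bc = proj₂ (walk-avoiding bc-avoiding-a)
    ac : WalkIn (b ≁_) _ a c
    ac = proj₂ (walk-avoiding ac-avoiding-b)
    c∈Rab : c ∈ R a b
    c∈Rab = ∈R-of-avoiding-walks j2 j4 j4' tw1' (head bc) (reverse (map ≁-sym ac)) (reverse bc)
    b∈Rac : b ∈ R a c
    b∈Rac = ∈R-of-avoiding-walks j2 j4 j4' tw1' (last bc) (reverse (map ≁-sym ab)) bc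

theorem8 : (m : ℕ) → (R : RMap (suc m)) → IsTransit R
           → B1' R → J2 R → J4 R → J4' R → TW1' R
           → ATFree (Adj R)
theorem8 _ _ = at-free
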